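{- For all $n_1,n_2\in\mathbb{Z}$ with $n_1<n_2$, $\mathrm{MTL}^{\mathcal{I}[n_2]}$ is strictly more expressive than $\mathrm{MTL}^{\mathcal{I}[n_1]}$, where $\mathcal{I}[n]=\{m\in\mathbb{Z}\mid m\le n\}\cup\{ -\infty,+\infty\}$.
   Context: Data words: infinite sequences $(P_0,d_0)(P_1,d_1)\dots$ with $P_i\subseteq\mathcal{P}$ ($\mathcal{P}$ a finite set of propositions) and $d_i\in\mathbb{N}$. MTL formulas: $\varphi::=p\mid\neg\varphi\mid\varphi_1\wedge\varphi_2\mid\varphi_1\mathsf{U}_I\varphi_2$, $I$ an integer interval (open/closed/half-open, possibly unbounded) with endpoints in $\mathbb{Z}\cup\{\pm\infty\}$; $(w,i)\models p$ iff $p\in P_i$; $(w,i)\models\varphi_1\mathsf{U}_I\varphi_2$ iff there is $j>i$ with $(w,j)\models\varphi_2$, $d_j-d_i\in I$, and $(w,k)\models\varphi_1$ for all $i<k<j$; $w\models\varphi$ iff $(w,0)\models\varphi$. For a set $\mathcal{I}=S\cup\{\pm\infty\}$ with $S\subseteq\mathbb{Z}$, $\mathrm{MTL}^{\mathcal{I}}$ is the set of MTL formulas in which every endpoint of every interval $I$ in an operator $\mathsf{U}_I$ lies in $\mathcal{I}$. A logic $\mathcal{L}'$ is strictly more expressive than $\mathcal{L}$ if every formula of $\mathcal{L}$ is satisfied by the same data words as some formula of $\mathcal{L}'$, but some formula of $\mathcal{L}'$ has no such counterpart in $\mathcal{L}$. -}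

module Defs where

open import Data.Nat using (ℕ; _<_)
open import Data.Integer as ℤ using (ℤ; +_; _-_)
open import Data.Bool using (Bool)
open import Data.Fin using (Fin)
open import Data.Fin.Subset using (Subset; _∈_)
open import Data.Product using (Σ; _×_; proj₁; proj₂)
open import Data.Sum using (_⊎_)
open import Data.Empty using (⊥)
open import Data.Unit using (⊤)
open import Relation.Binary.PropositionalEquality using (_≡_)
open import Relation.Nullary using (¬_)
open import Function.Bundles using (_⇔_)
open import Level using (0ℓ)

DataWord : ℕ → Set
DataWord k = ℕ → Subset k × ℕ

props : ∀ {k} → DataWord k → ℕ → Subset k
props w i = proj₁ (w i)

datum : ∀ {k} → DataWord k → ℕ → ℕ
datum w i = proj₂ (w i)

data Endpoint : Set where
  -∞ : Endpoint
  +∞ : Endpoint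
  fin : ℤ → Endpoint

-- An integer interval: lower endpoint, whether it is closed, upper endpoint,
-- whether it is closed.  Closedness flags at infinite endpoints are irrelevant.
record Interval : Set where
  constructor interval
  field
    lo       : Endpoint
    loClosed : Bool
    hi       : Endpoint
    hiClosed : Bool

open Interval public

AboveLo : Endpoint → Bool → ℤ → Set
AboveLo -∞ _ x = ⊤
AboveLo +∞ _ x = ⊥
AboveLo (fin a) Bool.true  x = a ℤ.≤ x
AboveLo (fin a) Bool.false x = a ℤ.< x

BelowHi : Endpoint → Bool → ℤ → Set
BelowHi -∞ _ x = ⊥
BelowHi +∞ _ x = ⊤
BelowHi (fin b) Bool.true  x = x ℤ.≤ b
BelowHi (fin b) Bool.false x = x ℤ.< b

_∈I_ : ℤ → Interval → Set
x ∈I I = AboveLo (lo I) (loClosed I) x × BelowHi (hi I) (hiClosed I) x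

data MTL (k : ℕ) : Set where
  atom  : Fin k → MTL k
  ¬'_   : MTL k → MTL k
  _∧'_  : MTL k → MTL k → MTL k
  _U[_]_ : MTL k → Interval → MTL k → MTL k

_,_⊨_ : ∀ {k} → DataWord k → ℕ → MTL k → Set
w , i ⊨ atom p = p ∈ props w i
w , i ⊨ (¬' φ) = ¬ (w , i ⊨ φ)
w , i ⊨ (φ ∧' ψ) = (w , i ⊨ φ) × (w , i ⊨ ψ)
w , i ⊨ (φ U[ I ] ψ) =
  Σ ℕ λ j → (i < j) × (w , j ⊨ ψ)
          × ((+ datum w j - + datum w i) ∈I I)
          × (∀ m → i < m → m < j → w , m ⊨ φ)

_⊨_ : ∀ {k} → DataWord k → MTL k → Set
w ⊨ φ = w , 0 ⊨ φ

EndpointSet : Set₁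
EndpointSet = Endpoint → Set

𝓘[_] : ℤ → EndpointSet
𝓘[ n ] -∞ = ⊤
𝓘[ n ] +∞ = ⊤
𝓘[ n ] (fin m) = m ℤ.≤ n

InFragment : ∀ {k} → EndpointSet → MTL k → Set
InFragment 𝓘 (atom p) = ⊤
InFragment 𝓘 (¬' φ) = InFragment 𝓘 φ
InFragment 𝓘 (φ ∧' ψ) = InFragment 𝓘 φ × InFragment 𝓘 ψ
InFragment 𝓘 (φ U[ I ] ψ) =
  𝓘 (lo I) × 𝓘 (hi I) × InFragment 𝓘 φ × InFragment 𝓘 ψ

Equivalent : ∀ {k} → MTL k → MTL k → Set
Equivalent {k} φ ψ = (w : DataWord k) → (w ⊨ φ) ⇔ (w ⊨ ψ)

AtLeastAsExpressive : ℕ → EndpointSet → EndpointSet → Set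
AtLeastAsExpressive k L' L =
  (φ : MTL k) → InFragment L φ → Σ (MTL k) λ ψ → InFragment L' ψ × Equivalent φ ψ

StrictlyMoreExpressive : ℕ → EndpointSet → EndpointSet → Set
StrictlyMoreExpressive k L' L =
  AtLeastAsExpressive k L' L
  × Σ (MTL k) λ ψ → InFragment L' ψ
      × ¬ (Σ (MTL k) λ φ → InFragment L φ × Equivalent φ ψ)

-- A formula of MTL^𝓘[n] compares datum differences only with thresholds ≤ n, so it
-- cannot tell a difference x from a difference y as soon as both exceed n.  The data
-- words 0 ↦ a, i+1 ↦ b and 0 ↦ a, i+1 ↦ b+1 with b − a = n₂ > n₁ therefore satisfy the
-- same MTL^𝓘[n₁] formulas, whereas ⊤ U_[n₂,n₂] ⊤ holds in the first and not in the second.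
-- Conversely MTL^𝓘[n₁] ⊆ MTL^𝓘[n₂] syntactically.
module Submission where

open import Defs
open import Data.Nat as ℕ using (ℕ; suc; zero; z<s)
open import Data.Integer as ℤ using (ℤ; +_; -[1+_]; _-_; _<_; _≤_)
import Data.Nat.Properties as ℕ
import Data.Integer.Properties as ℤ
open import Data.Bool using (true; false)
import Data.Fin as Fin
open import Data.Fin.Subset using (_∈_) renaming (⊥ to ∅)
open import Data.Product using (Σ; _×_; _,_; proj₁; proj₂)
open import Data.Sum using (_⊎_; inj₁; inj₂)
open import Data.Empty using (⊥-elim)
open import Data.Unit using (tt)
open import Relation.Binary.PropositionalEquality using (_≡_; refl; sym; trans; cong; subst)
open import Relation.Nullary using (¬_)
open import Function.Bundles using (mk⇔; Equivalence)

InFragment-mono : ∀ {k} {L L′ : EndpointSet} → (∀ e → L e → L′ e) →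
                  (φ : MTL k) → InFragment L φ → InFragment L′ φ
InFragment-mono L⊆L′ (atom p) _ = tt
InFragment-mono L⊆L′ (¬' φ) f = InFragment-mono L⊆L′ φ f
InFragment-mono L⊆L′ (φ ∧' ψ) (f , g) = InFragment-mono L⊆L′ φ f , InFragment-mono L⊆L′ ψ g
InFragment-mono L⊆L′ (φ U[ I ] ψ) (l , h , f , g) =
  L⊆L′ (lo I) l , L⊆L′ (hi I) h , InFragment-mono L⊆L′ φ f , InFragment-mono L⊆L′ ψ g

𝓘[]-mono : ∀ {n₁ n₂} → n₁ ≤ n₂ → ∀ e → 𝓘[ n₁ ] e → 𝓘[ n₂ ] e
𝓘[]-mono n₁≤n₂ -∞ _ = tt
𝓘[]-mono n₁≤n₂ +∞ _ = tt
𝓘[]-mono n₁≤n₂ (fin m) m≤n₁ = ℤ.≤-trans m≤n₁ n₁≤n₂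

𝓘[]-mono-expressive : ∀ k {n₁ n₂} → n₁ ≤ n₂ → AtLeastAsExpressive k 𝓘[ n₂ ] 𝓘[ n₁ ]
𝓘[]-mono-expressive k n₁≤n₂ φ f =
  φ , InFragment-mono (𝓘[]-mono n₁≤n₂) φ f , λ _ → mk⇔ (λ φ₁ → φ₁) (λ φ₂ → φ₂)

-- Differences that no interval with endpoints in 𝓘[n] can separate.
_∼[_]_ : ℤ → ℤ → ℤ → Set
x ∼[ n ] y = x ≡ y ⊎ (n < x × n < y)

∼-sym : ∀ {n x y} → x ∼[ n ] y → y ∼[ n ] x
∼-sym (inj₁ x≡y) = inj₁ (sym x≡y)
∼-sym (inj₂ (n<x , n<y)) = inj₂ (n<y , n<x)

AboveLo-resp-∼ : ∀ {n x y} e c → 𝓘[ n ] e → x ∼[ n ] y → AboveLo e c x → AboveLo e c y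
AboveLo-resp-∼ -∞ c _ _ _ = tt
AboveLo-resp-∼ (fin m) c _ (inj₁ refl) m≤x = m≤x
AboveLo-resp-∼ (fin m) true m≤n (inj₂ (_ , n<y)) _ = ℤ.<⇒≤ (ℤ.≤-<-trans m≤n n<y)
AboveLo-resp-∼ (fin m) false m≤n (inj₂ (_ , n<y)) _ = ℤ.≤-<-trans m≤n n<y

BelowHi-resp-∼ : ∀ {n x y} e c → 𝓘[ n ] e → x ∼[ n ] y → BelowHi e c x → BelowHi e c y
BelowHi-resp-∼ +∞ c _ _ _ = tt
BelowHi-resp-∼ (fin m) c _ (inj₁ refl) x≤m = x≤m
BelowHi-resp-∼ (fin m) true m≤n (inj₂ (n<x , _)) x≤m = ⊥-elim (ℤ.<⇒≱ n<x (ℤ.≤-trans x≤m m≤n))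
BelowHi-resp-∼ (fin m) false m≤n (inj₂ (n<x , _)) x<m =
  ⊥-elim (ℤ.<⇒≱ n<x (ℤ.≤-trans (ℤ.<⇒≤ x<m) m≤n))

∈I-resp-∼ : ∀ {n x y} I → 𝓘[ n ] (lo I) → 𝓘[ n ] (hi I) → x ∼[ n ] y → x ∈I I → y ∈I I
∈I-resp-∼ I l h x∼y (above , below) =
  AboveLo-resp-∼ (lo I) (loClosed I) l x∼y above , BelowHi-resp-∼ (hi I) (hiClosed I) h x∼y below

Δ : ∀ {k} → DataWord k → ℕ → ℕ → ℤ
Δ w i j = + datum w j - + datum w i

record Indistinguishable {k} (n : ℤ) (w₁ w₂ : DataWord k) : Set where
  field
    props-≡ : ∀ i → props w₁ i ≡ props w₂ i
    Δ-∼     : ∀ i j → i ℕ.< j → Δ w₁ i j ∼[ n ] Δ w₂ i j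

Indistinguishable-sym : ∀ {k n} {w₁ w₂ : DataWord k} →
                        Indistinguishable n w₁ w₂ → Indistinguishable n w₂ w₁
Indistinguishable-sym ind = record
  { props-≡ = λ i → sym (props-≡ i)
  ; Δ-∼     = λ i j i<j → ∼-sym (Δ-∼ i j i<j)
  }
  where open Indistinguishable ind

⊨-transfer : ∀ {k n} {w₁ w₂ : DataWord k} → Indistinguishable n w₁ w₂ →
             ∀ φ → InFragment 𝓘[ n ] φ → ∀ i → _,_⊨_ w₁ i φ → _,_⊨_ w₂ i φ
⊨-transfer ind (atom p) _ i p∈ = subst (p ∈_) (Indistinguishable.props-≡ ind i) p∈
⊨-transfer ind (¬' φ) f i ¬φ φ₂ = ¬φ (⊨-transfer (Indistinguishable-sym ind) φ f i φ₂)
⊨-transfer ind (φ ∧' ψ) (f , g) i (φ₁ , ψ₁) = ⊨-transfer ind φ f i φ₁ , ⊨-transfer ind ψ g i ψ₁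
⊨-transfer ind (φ U[ I ] ψ) (l , h , f , g) i (j , i<j , ψ₁ , Δ∈I , φ₁) =
  j , i<j , ⊨-transfer ind ψ g j ψ₁ ,
  ∈I-resp-∼ I l h (Indistinguishable.Δ-∼ ind i j i<j) Δ∈I ,
  λ m i<m m<j → ⊨-transfer ind φ f m (φ₁ m i<m m<j)

ℤ-as-ℕ-difference : ∀ x → Σ (ℕ × ℕ) λ (a , b) → + b - + a ≡ x
ℤ-as-ℕ-difference (+ b) = (0 , b) , cong +_ (ℕ.+-identityʳ b)
ℤ-as-ℕ-difference -[1+ a ] = (suc a , 0) , refl

stepWord : ∀ {k} → ℕ → ℕ → DataWord k
stepWord a b zero = ∅ , a
stepWord a b (suc _) = ∅ , b

stepWord-Δ-late : ∀ {k} a b i j → Δ (stepWord {k} a b) (suc i) (suc j) ≡ + 0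
stepWord-Δ-late a b i j = ℤ.+-inverseʳ (+ b)

stepWord-indistinguishable : ∀ {k n} a b b′ → n < + b - + a → n < + b′ - + a →
                             Indistinguishable n (stepWord {k} a b) (stepWord a b′)
stepWord-indistinguishable {k} a b b′ n<Δ n<Δ′ = record
  { props-≡ = λ { zero → refl ; (suc _) → refl }
  ; Δ-∼     = λ where
      zero (suc j) _ → inj₂ (n<Δ , n<Δ′)
      (suc i) (suc j) _ → inj₁ (trans (stepWord-Δ-late {k} a b i j) (sym (stepWord-Δ-late {k} a b′ i j)))
  }

⊤′ : ∀ {k} → MTL (suc k)
⊤′ = ¬' (atom Fin.zero ∧' (¬' atom Fin.zero))

⊤′-holds : ∀ {k} (w : DataWord (suc k)) i → _,_⊨_ w i ⊤′
⊤′-holds w i (p , ¬p) = ¬p p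

reaches : ∀ {k} → ℤ → MTL (suc k)
reaches x = ⊤′ U[ interval (fin x) true (fin x) true ] ⊤′

stepWord-⊨-reaches : ∀ {k} a b x → + b - + a ≡ x → stepWord {suc k} a b ⊨ reaches x
stepWord-⊨-reaches a b _ refl =
  1 , z<s , ⊤′-holds (stepWord a b) 1 , (ℤ.≤-refl , ℤ.≤-refl) , λ m 0<m m<1 → ⊥-elim (ℕ.<⇒≱ 0<m (ℕ.≤-pred m<1))

stepWord-⊨-reaches⁻¹ : ∀ {k} a b x → stepWord {suc k} a b ⊨ reaches x → + b - + a ≡ x
stepWord-⊨-reaches⁻¹ a b x (suc j , _ , _ , (x≤Δ , Δ≤x) , _) = ℤ.≤-antisym Δ≤x x≤Δ

proposition2 : (k : ℕ) (n₁ n₂ : ℤ) → n₁ < n₂ →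
    StrictlyMoreExpressive (suc k) 𝓘[ n₂ ] 𝓘[ n₁ ]
proposition2 k n₁ n₂ n₁<n₂ =
  𝓘[]-mono-expressive (suc k) (ℤ.<⇒≤ n₁<n₂) ,
  reaches n₂ , (ℤ.≤-refl , ℤ.≤-refl , (tt , tt) , (tt , tt)) , inexpressible
  where
  a b : ℕ
  a = proj₁ (proj₁ (ℤ-as-ℕ-difference n₂))
  b = proj₂ (proj₁ (ℤ-as-ℕ-difference n₂))

  Δ≡n₂ : + b - + a ≡ n₂
  Δ≡n₂ = proj₂ (ℤ-as-ℕ-difference n₂)

  n₂<Δ′ : n₂ < + suc b - + a
  n₂<Δ′ = subst (_< + suc b - + a) Δ≡n₂ (ℤ.+-monoˡ-< (ℤ.- + a) (ℤ.+<+ (ℕ.n<1+n b)))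

  indistinguishable : Indistinguishable n₁ (stepWord a b) (stepWord a (suc b))
  indistinguishable = stepWord-indistinguishable a b (suc b)
    (subst (n₁ <_) (sym Δ≡n₂) n₁<n₂) (ℤ.<-trans n₁<n₂ n₂<Δ′)

  inexpressible : ¬ (Σ (MTL (suc k)) λ φ → InFragment 𝓘[ n₁ ] φ × Equivalent φ (reaches n₂))
  inexpressible (φ , f , φ⇔reaches) =
    ℤ.<⇒≢ n₂<Δ′ (sym (stepWord-⊨-reaches⁻¹ a (suc b) n₂ (Equivalence.to (φ⇔reaches _)
      (⊨-transfer indistinguishable φ f 0 (Equivalence.from (φ⇔reaches _)
        (stepWord-⊨-reaches a b n₂ Δ≡n₂))))))
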